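{- There exists an infinite family of graphs $G_1,G_2,\dots$ such that $A_b(G_n)-\Delta(G_n)\to\infty$ as $n\to\infty$.
   Context: $\Delta(G)$ denotes the maximum degree of $G$. A (proper) $k$-coloring of $G$ is a map $c:V(G)\to[k]$ with adjacent vertices colored differently, all $k$ colors used; $V_i=c^{ -1}(i)$. A coloring is acyclic if $G[V_i\cup V_j]$ is a forest for all $i,j$. A vertex $v$ is a b-vertex if the colors on $v$ and its neighbors are all $k$ colors. A recoloring step applied to $c$ and a color $i$ having no b-vertex recolors every $v\in V_i$ with a color not appearing on $v$ or its neighbors, producing a $(k-1)$-coloring; if both colorings are acyclic it is an acyclic recoloring step. The acyclic b-chromatic number $A_b(G)$ is the maximum number of colors of an acyclic coloring of $G$ to which no acyclic recoloring step can be applied. -}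

module Defs where

open import Data.Nat using (ℕ; zero; suc; _≤_; _⊔_; _+_)
open import Data.Fin using (Fin)
open import Data.Bool using (Bool; true; false)
open import Data.List using (List; []; _∷_; _++_; [_]; length; filter; map; foldr; allFin)
open import Data.List.Relation.Unary.Unique.Propositional using (Unique)
open import Data.Product using (Σ; ∃; ∃-syntax; _×_; _,_)
open import Data.Sum using (_⊎_)
open import Data.Unit using (⊤)
open import Relation.Nullary using (¬_)
open import Relation.Binary.PropositionalEquality using (_≡_; _≢_)
open import Data.Bool.Properties using (T?)
open import Data.Bool using (T)

record Graph : Set where
  field
    order : ℕ
    adj   : Fin order → Fin order → Bool
    sym   : ∀ u v → adj u v ≡ adj v u
    irrefl : ∀ v → adj v v ≡ false

open Graph public

V : Graph → Set
V G = Fin (order G)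

Adj : (G : Graph) → V G → V G → Set
Adj G u v = adj G u v ≡ true

degree : (G : Graph) → V G → ℕ
degree G v = length (filter (λ w → T? (adj G v w)) (allFin (order G)))

Δ : Graph → ℕ
Δ G = foldr _⊔_ 0 (map (degree G) (allFin (order G)))

ConsecAdj : (G : Graph) → List (V G) → Set
ConsecAdj G [] = ⊤
ConsecAdj G (x ∷ []) = ⊤
ConsecAdj G (x ∷ y ∷ r) = Adj G x y × ConsecAdj G (y ∷ r)

CycleIn : (G : Graph) → (V G → Set) → Set
CycleIn G P = ∃[ x ] ∃[ xs ]
  ( 3 ≤ length (x ∷ xs)
  × Unique (x ∷ xs)
  × ConsecAdj G ((x ∷ xs) ++ [ x ])
  × P x × AllP xs )
  where
  AllP : List (V G) → Set
  AllP [] = ⊤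
  AllP (y ∷ ys) = P y × AllP ys

Proper : (G : Graph) {k : ℕ} → (V G → Fin k) → Set
Proper G c = ∀ u v → Adj G u v → c u ≢ c v

IsColoring : (G : Graph) (k : ℕ) → (V G → Fin k) → Set
IsColoring G k c = Proper G c × (∀ (i : Fin k) → ∃[ v ] c v ≡ i)

Acyclic : (G : Graph) {k : ℕ} → (V G → Fin k) → Set
Acyclic G c = ∀ i j → ¬ CycleIn G (λ v → c v ≡ i ⊎ c v ≡ j)

IsBVertex : (G : Graph) {k : ℕ} → (V G → Fin k) → V G → Set
IsBVertex G {k} c v = ∀ (j : Fin k) → c v ≡ j ⊎ ∃[ w ] (Adj G v w × c w ≡ j)

-- The resulting map uses the
-- k-1 colours [k] ∖ {i}; it is the (k-1)-coloring produced by the step.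
RecoloringStep : (G : Graph) {k : ℕ} → (V G → Fin k) → Fin k → (V G → Fin k) → Set
RecoloringStep G c i c' =
  (∀ v → c v ≡ i → ¬ IsBVertex G c v)
  × (∀ v → c v ≢ i → c' v ≡ c v)
  × (∀ v → c v ≡ i → (c' v ≢ c v × (∀ w → Adj G v w → c' v ≢ c w)))

AcyclicStepApplicable : (G : Graph) {k : ℕ} → (V G → Fin k) → Set
AcyclicStepApplicable G c =
  ∃[ i ] ∃[ c' ] (RecoloringStep G c i c' × Acyclic G c × Acyclic G c')

Good : (G : Graph) (k : ℕ) → (V G → Fin k) → Set
Good G k c = IsColoring G k c × Acyclic G c × ¬ AcyclicStepApplicable G c

IsAb : Graph → ℕ → Set
IsAb G a = (∃[ c ] Good G a c) × (∀ k (c : V G → Fin k) → Good G k c → k ≤ a)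

{-# OPTIONS --safe #-}
module Submission where

-- Let H consist of two disjoint copies (layers) of K_{t,t}, with sides A₁, B₁ and A₂, B₂, and one
-- edge between the zeroth vertices of A₁ and B₂, and let G be its complement, so Δ(G) ≤ 3t.
-- Colour classes of G are cliques of the triangle-free H, so they have at most two vertices, and a
-- proper colouring is then acyclic unless two classes span a 4-cycle of G.  If at most one class had
-- two vertices, a singleton class {w} could be recoloured with the colour of a singleton class {y}
-- with w ≁ y, an acyclic recolouring step; so every good colouring has two classes of size two
-- and at most 4t − 2 colours.  The colouring whose two-vertex classes are the zeroth vertices of
-- A₁, B₁ and of A₂, B₂ is good: in any recolouring step a vertex v takes the colour of an H-neighbour
-- x, and v, x and the class of the other copy form a bichromatic 4-cycle.  Hence A_b(G) − Δ(G) ≥ t − 2.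

open import Defs renaming (sym to adj-sym)
open import Data.Nat using (ℕ; zero; suc; z≤n; s≤s; _≤_; _≤?_; _+_)
import Data.Nat.Properties as ℕ
open import Data.Nat.Tactic.RingSolver using (solve-∀)
open import Data.Fin as Fin using (Fin; zero; suc; punchIn; punchOut; _↑ˡ_; _↑ʳ_; splitAt; join)
open import Data.Fin.Properties
  using (any?; suc-injective; 0≢1+n; punchIn-punchOut; punchOut-injective; injective⇒≤;
         splitAt-↑ˡ; splitAt-↑ʳ; join-splitAt)
open import Data.Product using (Σ-syntax; ∃₂; ∃-syntax; _×_; _,_; proj₁; proj₂)
open import Data.Sum using (_⊎_; inj₁; inj₂; [_,_]′)
open import Data.Empty using (⊥; ⊥-elim)
open import Data.Unit using (tt)
open import Data.Bool using (Bool; true; false; not; _∧_)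
open import Data.Bool.Properties using (T?; T-≡; ∧-zeroʳ; ¬-not) renaming (_≟_ to _≟ᴮ_)
open import Data.List using (List; []; _∷_; _++_; length; filter; tabulate; allFin)
open import Data.List.Properties
  using (length-++; filter-++; length-filter; length-tabulate; filter-none; foldr-preservesᵇ)
open import Data.List.Relation.Unary.All using ([]; _∷_)
open import Data.List.Relation.Unary.All.Properties using (tabulate⁺; map⁺)
open import Data.List.Relation.Unary.AllPairs using ([]; _∷_)
open import Function using (_∘_)
open import Function.Bundles using (Equivalence)
open import Relation.Nullary using (¬_; Dec; yes; no; does; _×-dec_; ¬?)
open import Relation.Nullary.Decidable using (dec-true; dec-false; decidable-stable)
open import Relation.Unary using (Decidable)
open import Relation.Binary.PropositionalEquality
  using (_≡_; _≢_; refl; sym; trans; cong; cong₂; subst; module ≡-Reasoning)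

-- Colourings whose classes have at most two vertices

alternate : ∀ {A : Set} {i j x y z : A} →
  x ≡ i ⊎ x ≡ j → y ≡ i ⊎ y ≡ j → z ≡ i ⊎ z ≡ j → x ≢ y → y ≢ z → x ≡ z
alternate (inj₁ x≡i) _         (inj₁ z≡i) _   _   = trans x≡i (sym z≡i)
alternate (inj₂ x≡j) _         (inj₂ z≡j) _   _   = trans x≡j (sym z≡j)
alternate (inj₁ x≡i) (inj₁ y≡i) (inj₂ _)  x≢y _   = ⊥-elim (x≢y (trans x≡i (sym y≡i)))
alternate (inj₁ _)   (inj₂ y≡j) (inj₂ z≡j) _  y≢z = ⊥-elim (y≢z (trans y≡j (sym z≡j)))
alternate (inj₂ x≡j) (inj₂ y≡j) (inj₁ _)  x≢y _   = ⊥-elim (x≢y (trans x≡j (sym y≡j)))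
alternate (inj₂ _)   (inj₁ y≡i) (inj₁ z≡i) _  y≢z = ⊥-elim (y≢z (trans y≡i (sym z≡i)))

adj⇒≢ : (G : Graph) {u v : V G} → Adj G u v → u ≢ v
adj⇒≢ G {u} uv refl with trans (sym uv) (irrefl G u)
... | ()

adj-comm : (G : Graph) {u v : V G} → Adj G u v → Adj G v u
adj-comm G {u} {v} uv = trans (adj-sym G v u) uv

ClassSize≤2 : (G : Graph) {k : ℕ} → (V G → Fin k) → Set
ClassSize≤2 G c = ∀ a b d → a ≢ b → b ≢ d → a ≢ d → c a ≡ c b → c b ≡ c d → ⊥

NoBichromaticC₄ : (G : Graph) {k : ℕ} → (V G → Fin k) → Set
NoBichromaticC₄ G c = ∀ a b p q → a ≢ b → c a ≡ c b → p ≢ q → c p ≡ c q → c a ≢ c p →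
  Adj G a p → Adj G p b → Adj G b q → Adj G q a → ⊥

-- A properly two-coloured cycle alternates, so a cycle of length ≥ 5 repeats a colour three
-- times, and one of length 4 is a bichromatic C₄.
acyclic-if-noBichromaticC₄ : (G : Graph) {k : ℕ} (c : V G → Fin k) →
  Proper G c → ClassSize≤2 G c → NoBichromaticC₄ G c → Acyclic G c
acyclic-if-noBichromaticC₄ G c proper size≤2 noC₄ i j (_ , [] , s≤s () , _)
acyclic-if-noBichromaticC₄ G c proper size≤2 noC₄ i j (_ , _ ∷ [] , s≤s (s≤s ()) , _)
acyclic-if-noBichromaticC₄ G c proper size≤2 noC₄ i j
  (x , x₁ ∷ x₂ ∷ [] , _ , _ , (a₀₁ , a₁₂ , a₂₀ , _) , in₀ , in₁ , in₂ , _) =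
  proper x₂ x a₂₀ (sym (alternate in₀ in₁ in₂ (proper _ _ a₀₁) (proper _ _ a₁₂)))
acyclic-if-noBichromaticC₄ G c proper size≤2 noC₄ i j
  (x , x₁ ∷ x₂ ∷ x₃ ∷ [] , _ , ((_ ∷ x≢x₂ ∷ _) ∷ (_ ∷ x₁≢x₃ ∷ _) ∷ _) ,
   (a₀₁ , a₁₂ , a₂₃ , a₃₀ , _) , in₀ , in₁ , in₂ , in₃ , _) =
  noC₄ x x₂ x₁ x₃ x≢x₂ (alternate in₀ in₁ in₂ (proper _ _ a₀₁) (proper _ _ a₁₂))
       x₁≢x₃ (alternate in₁ in₂ in₃ (proper _ _ a₁₂) (proper _ _ a₂₃))
       (proper _ _ a₀₁) a₀₁ a₁₂ a₂₃ a₃₀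
acyclic-if-noBichromaticC₄ G c proper size≤2 noC₄ i j
  (x , x₁ ∷ x₂ ∷ x₃ ∷ x₄ ∷ _ , _ , ((_ ∷ x≢x₂ ∷ _ ∷ x≢x₄ ∷ _) ∷ _ ∷ (_ ∷ x₂≢x₄ ∷ _) ∷ _) ,
   (a₀₁ , a₁₂ , a₂₃ , a₃₄ , _) , in₀ , in₁ , in₂ , in₃ , in₄ , _) =
  size≤2 x x₂ x₄ x≢x₂ x₂≢x₄ x≢x₄ (alternate in₀ in₁ in₂ (proper _ _ a₀₁) (proper _ _ a₁₂))
                                  (alternate in₂ in₃ in₄ (proper _ _ a₂₃) (proper _ _ a₃₄))

acyclic⇒noBichromaticC₄ : (G : Graph) {k : ℕ} (c : V G → Fin k) → Acyclic G c → NoBichromaticC₄ G c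
acyclic⇒noBichromaticC₄ G c acyclic a b p q a≢b ca≡cb p≢q cp≡cq ca≢cp ap pb bq qa =
  acyclic (c a) (c p) (a , p ∷ b ∷ q ∷ [] , s≤s (s≤s (s≤s z≤n)) ,
    ((a≢p ∷ a≢b ∷ a≢q ∷ []) ∷ (p≢b ∷ p≢q ∷ []) ∷ (b≢q ∷ []) ∷ [] ∷ []) ,
    (ap , pb , bq , qa , tt) , inj₁ refl , inj₂ refl , inj₁ (sym ca≡cb) , inj₂ (sym cp≡cq) , tt)
  where
  a≢p : a ≢ p
  a≢p refl = ca≢cp refl
  a≢q : a ≢ q
  a≢q refl = ca≢cp (sym cp≡cq)
  p≢b : p ≢ b
  p≢b refl = ca≢cp ca≡cb
  b≢q : b ≢ q
  b≢q refl = ca≢cp (trans ca≡cb (sym cp≡cq))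

Singleton : (G : Graph) {k : ℕ} → (V G → Fin k) → V G → Set
Singleton G c w = ∀ z → c z ≡ c w → z ≡ w

record MergeableSingletons (G : Graph) {k : ℕ} (c : V G → Fin k) : Set where
  field
    w y : V G
    w≢y : w ≢ y
    w≁y : ¬ Adj G w y
    single-w : Singleton G c w
    single-y : Singleton G c y
    no-common-pair : ∀ a b → a ≢ b → c a ≡ c b → Adj G a w → Adj G b w → Adj G a y → Adj G b y → ⊥

module SingletonRecolouring (G : Graph) {k : ℕ} (c : V G → Fin k)
  (proper : Proper G c) (acyclic : Acyclic G c) (size≤2 : ClassSize≤2 G c)
  (M : MergeableSingletons G c)
  where

  open MergeableSingletons M

  c′ : V G → Fin k
  c′ z with z Fin.≟ w
  ... | yes _ = c y
  ... | no _  = c z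

  c′-at-w : ∀ {z} → z ≡ w → c′ z ≡ c y
  c′-at-w {z} z≡w with z Fin.≟ w
  ... | yes _   = refl
  ... | no z≢w = ⊥-elim (z≢w z≡w)

  c′-off-w : ∀ {z} → z ≢ w → c′ z ≡ c z
  c′-off-w {z} z≢w with z Fin.≟ w
  ... | yes z≡w = ⊥-elim (z≢w z≡w)
  ... | no _    = refl

  is-y : ∀ {z} → z ≢ w → c′ z ≡ c y → z ≡ y
  is-y z≢w c′z≡cy = single-y _ (trans (sym (c′-off-w z≢w)) c′z≡cy)

  cy-absent-at-w : c w ≢ c y
  cy-absent-at-w cw≡cy = w≢y (single-y w cw≡cy)

  cy-absent-near-w : ∀ z → Adj G w z → c y ≢ c z
  cy-absent-near-w z wz cy≡cz with single-y z (sym cy≡cz)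
  ... | refl = w≁y wz

  IsWY : V G → V G → Set
  IsWY a b = (a ≡ w × b ≡ y) ⊎ (a ≡ y × b ≡ w)

  c′-pair : ∀ {a b} → a ≢ b → c′ a ≡ c′ b → (a ≢ w × b ≢ w × c a ≡ c b) ⊎ IsWY a b
  c′-pair {a} {b} a≢b c′a≡c′b = by-cases (a Fin.≟ w) (b Fin.≟ w)
    where
    by-cases : Dec (a ≡ w) → Dec (b ≡ w) → (a ≢ w × b ≢ w × c a ≡ c b) ⊎ IsWY a b
    by-cases (yes a≡w) (yes b≡w) = ⊥-elim (a≢b (trans a≡w (sym b≡w)))
    by-cases (yes a≡w) (no b≢w)  = inj₂ (inj₁ (a≡w , is-y b≢w (trans (sym c′a≡c′b) (c′-at-w a≡w))))
    by-cases (no a≢w)  (yes b≡w) = inj₂ (inj₂ (is-y a≢w (trans c′a≡c′b (c′-at-w b≡w)) , b≡w))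
    by-cases (no a≢w)  (no b≢w)  =
      inj₁ (a≢w , b≢w , trans (sym (c′-off-w a≢w)) (trans c′a≡c′b (c′-off-w b≢w)))

  IsWY-colour : ∀ {a b} → IsWY a b → c′ a ≡ c y
  IsWY-colour (inj₁ (a≡w , _)) = c′-at-w a≡w
  IsWY-colour (inj₂ (refl , _)) = c′-off-w (w≢y ∘ sym)

  common-neighbour-of-WY : ∀ {a b z} → IsWY a b → Adj G z a → Adj G z b → Adj G z w × Adj G z y
  common-neighbour-of-WY (inj₁ (refl , refl)) za zb = za , zb
  common-neighbour-of-WY (inj₂ (refl , refl)) za zb = zb , za

  proper′ : Proper G c′
  proper′ a b ab c′a≡c′b with c′-pair (adj⇒≢ G ab) c′a≡c′b
  ... | inj₁ (_ , _ , ca≡cb)     = proper a b ab ca≡cb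
  ... | inj₂ (inj₁ (refl , refl)) = w≁y ab
  ... | inj₂ (inj₂ (refl , refl)) = w≁y (adj-comm G ab)

  size≤2′ : ClassSize≤2 G c′
  size≤2′ a b d a≢b b≢d a≢d ab bd = by-cases (a Fin.≟ w) (b Fin.≟ w) (d Fin.≟ w)
    where
    by-cases : Dec (a ≡ w) → Dec (b ≡ w) → Dec (d ≡ w) → ⊥
    by-cases (yes a≡w) _ _ =
      b≢d (trans (is-y (a≢b ∘ trans a≡w ∘ sym) (trans (sym ab) (c′-at-w a≡w)))
          (sym (is-y (a≢d ∘ trans a≡w ∘ sym) (trans (sym (trans ab bd)) (c′-at-w a≡w)))))
    by-cases (no a≢w) (yes b≡w) _ =
      a≢d (trans (is-y a≢w (trans ab (c′-at-w b≡w)))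
          (sym (is-y (b≢d ∘ trans b≡w ∘ sym) (trans (sym bd) (c′-at-w b≡w)))))
    by-cases (no a≢w) (no b≢w) (yes d≡w) =
      a≢b (trans (is-y a≢w (trans (trans ab bd) (c′-at-w d≡w))) (sym (is-y b≢w (trans bd (c′-at-w d≡w)))))
    by-cases (no a≢w) (no b≢w) (no d≢w) =
      size≤2 a b d a≢b b≢d a≢d (trans (sym (c′-off-w a≢w)) (trans ab (c′-off-w b≢w)))
                                (trans (sym (c′-off-w b≢w)) (trans bd (c′-off-w d≢w)))

  noC₄′ : NoBichromaticC₄ G c′
  noC₄′ a b p q a≢b ab p≢q pq c′a≢c′p ap pb bq qa with c′-pair a≢b ab | c′-pair p≢q pq
  ... | inj₁ (a≢w , b≢w , ca≡cb) | inj₁ (p≢w , q≢w , cp≡cq) =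
    acyclic⇒noBichromaticC₄ G c acyclic a b p q a≢b ca≡cb p≢q cp≡cq
      (λ ca≡cp → c′a≢c′p (trans (c′-off-w a≢w) (trans ca≡cp (sym (c′-off-w p≢w))))) ap pb bq qa
  ... | inj₁ (_ , _ , ca≡cb) | inj₂ wy =
    let aw , ay = common-neighbour-of-WY wy ap (adj-comm G qa)
        bw , by = common-neighbour-of-WY wy (adj-comm G pb) bq
    in no-common-pair a b a≢b ca≡cb aw bw ay by
  ... | inj₂ wy | inj₁ (_ , _ , cp≡cq) =
    let pw , py = common-neighbour-of-WY wy (adj-comm G ap) pb
        qw , qy = common-neighbour-of-WY wy qa (adj-comm G bq)
    in no-common-pair p q p≢q cp≡cq pw qw py qy
  ... | inj₂ wy | inj₂ wy′ = c′a≢c′p (trans (IsWY-colour wy) (sym (IsWY-colour wy′)))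

  acyclic-step : AcyclicStepApplicable G c
  acyclic-step = c w , c′ , (no-b-vertex , unchanged , recoloured) , acyclic ,
                 acyclic-if-noBichromaticC₄ G c′ proper′ size≤2′ noC₄′
    where
    no-b-vertex : ∀ v → c v ≡ c w → ¬ IsBVertex G c v
    no-b-vertex v cv≡cw b-vertex with single-w v cv≡cw | b-vertex (c y)
    ... | refl | inj₁ cw≡cy            = cy-absent-at-w cw≡cy
    ... | refl | inj₂ (z , wz , cz≡cy) = cy-absent-near-w z wz (sym cz≡cy)
    unchanged : ∀ v → c v ≢ c w → c′ v ≡ c v
    unchanged v cv≢cw = c′-off-w (cv≢cw ∘ cong c)
    recoloured : ∀ v → c v ≡ c w → c′ v ≢ c v × (∀ z → Adj G v z → c′ v ≢ c z)
    recoloured v cv≡cw with single-w v cv≡cw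
    ... | refl = (λ c′w≡cw → cy-absent-at-w (trans (sym c′w≡cw) (c′-at-w refl)))
               , (λ z wz c′w≡cz → cy-absent-near-w z wz (trans (sym (c′-at-w refl)) c′w≡cz))

surjective⇒≤ : ∀ {m k} (f : Fin m → Fin k) → (∀ i → ∃[ u ] f u ≡ i) → k ≤ m
surjective⇒≤ f surj = injective⇒≤ {f = proj₁ ∘ surj} λ {i} {j} eq →
  trans (sym (proj₂ (surj i))) (trans (cong f eq) (proj₂ (surj j)))

surjective-avoiding⇒≤ : ∀ {m k} (c : Fin (suc (suc m)) → Fin k) {v₁ v₂} → v₁ ≢ v₂ →
  (∀ i → ∃[ u ] (u ≢ v₁ × u ≢ v₂ × c u ≡ i)) → k ≤ m
surjective-avoiding⇒≤ c {v₁} {v₂} v₁≢v₂ attained =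
  surjective⇒≤ (c ∘ punchIn v₁ ∘ punchIn v₂′) preimage
  where
  v₂′ = punchOut v₁≢v₂
  preimage : ∀ i → ∃[ u ] c (punchIn v₁ (punchIn v₂′ u)) ≡ i
  preimage i with attained i
  ... | u , u≢v₁ , u≢v₂ , cu≡i = punchOut v₂′≢u′ , cu′≡i
    where
    u′ = punchOut (u≢v₁ ∘ sym)
    v₂′≢u′ : v₂′ ≢ u′
    v₂′≢u′ eq = u≢v₂ (sym (punchOut-injective v₁≢v₂ (u≢v₁ ∘ sym) eq))
    cu′≡i : c (punchIn v₁ (punchIn v₂′ (punchOut v₂′≢u′))) ≡ i
    cu′≡i = trans (cong (c ∘ punchIn v₁) (punchIn-punchOut v₂′≢u′))
                  (trans (cong c (punchIn-punchOut (u≢v₁ ∘ sym))) cu≡i)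

ColourRepeatedAway : ∀ {n k} → (Fin n → Fin k) → Fin n → Fin n → Fin n → Set
ColourRepeatedAway c v₁ v₂ v = ∃[ u ] (u ≢ v₁ × u ≢ v₂ × c u ≡ c v)

TwoRepeatedVertices : ∀ {n k} → (Fin n → Fin k) → Set
TwoRepeatedVertices c =
  ∃₂ λ v₁ v₂ → v₁ ≢ v₂ × ColourRepeatedAway c v₁ v₂ v₁ × ColourRepeatedAway c v₁ v₂ v₂

twoRepeated⇒≤ : ∀ {m k} (c : Fin (suc (suc m)) → Fin k) →
  (∀ i → ∃[ v ] c v ≡ i) → TwoRepeatedVertices c → k ≤ m
twoRepeated⇒≤ c surj (v₁ , v₂ , v₁≢v₂ , repeated₁ , repeated₂) =
  surjective-avoiding⇒≤ c v₁≢v₂ attained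
  where
  shift : ∀ {v i} → ColourRepeatedAway c v₁ v₂ v → c v ≡ i → ∃[ u ] (u ≢ v₁ × u ≢ v₂ × c u ≡ i)
  shift (u , u≢v₁ , u≢v₂ , cu≡cv) cv≡i = u , u≢v₁ , u≢v₂ , trans cu≡cv cv≡i
  attained : ∀ i → ∃[ u ] (u ≢ v₁ × u ≢ v₂ × c u ≡ i)
  attained i with surj i
  ... | u , cu≡i with u Fin.≟ v₁ | u Fin.≟ v₂
  ...   | yes refl | _        = shift repeated₁ cu≡i
  ...   | no _     | yes refl = shift repeated₂ cu≡i
  ...   | no u≢v₁  | no u≢v₂  = u , u≢v₁ , u≢v₂ , cu≡i

record SpareNonEdge (G : Graph) (u v : V G) : Set where
  field
    w y : V G
    w≢y : w ≢ y
    w≁y : ¬ Adj G w y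
    w≢u : w ≢ u
    w≢v : w ≢ v
    y≢u : y ≢ u
    y≢v : y ≢ v
    u≁w : ¬ Adj G u w

-- With at most one non-singleton class {u, v}, the spare non-edge wy can be merged into a single
-- class; u ≁ w keeps {u, v} out of the common neighbourhood of w and y.
good⇒¬¬twoRepeated : (G : Graph) {k : ℕ} (c : V G → Fin k) → Good G k c →
  (∃₂ λ u v → u ≢ v × ¬ Adj G u v) →
  (∀ u v → u ≢ v → ¬ Adj G u v → SpareNonEdge G u v) →
  ¬ ¬ TwoRepeatedVertices c
good⇒¬¬twoRepeated G c ((proper , _) , acyclic , stuck) (u₀ , v₀ , u₀≢v₀ , u₀≁v₀) spare noTwo =
  stuck (SingletonRecolouring.acyclic-step G c proper acyclic size≤2 mergeable)
  where
  size≤2 : ClassSize≤2 G c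
  size≤2 a b d a≢b b≢d a≢d ab bd =
    noTwo (b , d , b≢d , (a , a≢b , a≢d , ab) , (a , a≢b , a≢d , trans ab bd))

  mergeable : MergeableSingletons G c
  mergeable with any? (λ u → any? (λ v → ¬? (u Fin.≟ v) ×-dec (c u Fin.≟ c v)))
  ... | no noPair = record
    { w≢y = w≢y ; w≁y = w≁y ; single-w = singleton w ; single-y = singleton y
    ; no-common-pair = λ a b a≢b ca≡cb _ _ _ _ → noPair (a , b , a≢b , ca≡cb) }
    where
    open SpareNonEdge (spare u₀ v₀ u₀≢v₀ u₀≁v₀)
    singleton : ∀ z → Singleton G c z
    singleton z x cx≡cz = decidable-stable (x Fin.≟ z) λ x≢z → noPair (x , z , x≢z , cx≡cz)
  ... | yes (u , v , u≢v , cu≡cv) = record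
    { w≢y = w≢y ; w≁y = w≁y ; single-w = singleton-away w≢u w≢v ; single-y = singleton-away y≢u y≢v
    ; no-common-pair = no-common-pair }
    where
    open SpareNonEdge (spare u v u≢v (λ uv → proper u v uv cu≡cv))
    singleton-away : ∀ {z} → z ≢ u → z ≢ v → Singleton G c z
    singleton-away {z} z≢u z≢v x cx≡cz = decidable-stable (x Fin.≟ z) λ x≢z → noTwo (two x≢z)
      where
      two : x ≢ z → TwoRepeatedVertices c
      two x≢z with x Fin.≟ v
      ... | no x≢v   = z , v , z≢v , (x , x≢z , x≢v , cx≡cz) , (u , z≢u ∘ sym , u≢v , cu≡cv)
      ... | yes refl = z , u , z≢u , (x , x≢z , u≢v ∘ sym , cx≡cz) , (x , x≢z , u≢v ∘ sym , sym cu≡cv)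
    in-uv : ∀ {z x} → z ≢ x → c z ≡ c x → z ≡ u ⊎ z ≡ v
    in-uv {z} z≢x cz≡cx with z Fin.≟ u | z Fin.≟ v
    ... | yes z≡u | _       = inj₁ z≡u
    ... | no _    | yes z≡v = inj₂ z≡v
    ... | no z≢u  | no z≢v  = ⊥-elim (z≢x (sym (singleton-away z≢u z≢v _ (sym cz≡cx))))
    no-common-pair : ∀ a b → a ≢ b → c a ≡ c b → Adj G a w → Adj G b w → Adj G a y → Adj G b y → ⊥
    no-common-pair a b a≢b ca≡cb aw bw _ _ with in-uv a≢b ca≡cb | in-uv (a≢b ∘ sym) (sym ca≡cb)
    ... | inj₁ refl | _         = u≁w aw
    ... | inj₂ _    | inj₁ refl = u≁w bw
    ... | inj₂ refl | inj₂ refl = a≢b refl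

Δ≤ : (G : Graph) {B : ℕ} → (∀ v → degree G v ≤ B) → Δ G ≤ B
Δ≤ G {B} bound = foldr-preservesᵇ {P = _≤ B} ℕ.⊔-lub z≤n (map⁺ (tabulate⁺ bound))

tabulate-↑ : ∀ m {k} {A : Set} (f : Fin (m + k) → A) →
  tabulate f ≡ tabulate (f ∘ (_↑ˡ k)) ++ tabulate (f ∘ (m ↑ʳ_))
tabulate-↑ zero    f = refl
tabulate-↑ (suc m) f = cong (f zero ∷_) (tabulate-↑ m (f ∘ suc))

module _ {A : Set} {P : A → Set} (P? : Decidable P) where

  count-++ : ∀ xs ys → length (filter P? (xs ++ ys)) ≡ length (filter P? xs) + length (filter P? ys)
  count-++ xs ys = trans (cong length (filter-++ P? xs ys)) (length-++ (filter P? xs))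

  count-tabulate≤ : ∀ {m} (f : Fin m → A) → length (filter P? (tabulate f)) ≤ m
  count-tabulate≤ f = ℕ.≤-trans (length-filter P? (tabulate f)) (ℕ.≤-reflexive (length-tabulate f))

  count-tabulate-none : ∀ {m} (f : Fin m → A) → (∀ i → ¬ P (f i)) → length (filter P? (tabulate f)) ≡ 0
  count-tabulate-none f none = cong length (filter-none P? (tabulate⁺ none))

sum-of-four≤ : ∀ {t a b c d} → a ≤ t → b ≤ t → c ≤ t → d ≤ t →
  a ≡ 0 ⊎ b ≡ 0 ⊎ c ≡ 0 ⊎ d ≡ 0 → a + (b + (c + d)) ≤ t + (t + t)
sum-of-four≤ a≤ b≤ c≤ d≤ (inj₁ refl)                = ℕ.+-mono-≤ b≤ (ℕ.+-mono-≤ c≤ d≤)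
sum-of-four≤ a≤ b≤ c≤ d≤ (inj₂ (inj₁ refl))         = ℕ.+-mono-≤ a≤ (ℕ.+-mono-≤ c≤ d≤)
sum-of-four≤ a≤ b≤ c≤ d≤ (inj₂ (inj₂ (inj₁ refl)))  = ℕ.+-mono-≤ a≤ (ℕ.+-mono-≤ b≤ d≤)
sum-of-four≤ {c = c} a≤ b≤ c≤ d≤ (inj₂ (inj₂ (inj₂ refl))) rewrite ℕ.+-identityʳ c =
  ℕ.+-mono-≤ a≤ (ℕ.+-mono-≤ b≤ c≤)

-- The complement of two copies of K_{t,t} joined by one edge

data Layer : Set where
  upper lower : Layer

data Side : Set where
  left right : Side

Part : Set
Part = Layer × Side

pattern A₁ = upper , left
pattern B₁ = upper , right
pattern A₂ = lower , left
pattern B₂ = lower , right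

flipᴸ : Layer → Layer
flipᴸ upper = lower
flipᴸ lower = upper

flipˢ : Side → Side
flipˢ left  = right
flipˢ right = left

opp : Part → Part
opp (ℓ , s) = ℓ , flipˢ s

across : Part → Part
across (ℓ , s) = flipᴸ ℓ , s

flipᴸ≢ : ∀ ℓ → flipᴸ ℓ ≢ ℓ
flipᴸ≢ upper ()
flipᴸ≢ lower ()

opp≢ : ∀ p → opp p ≢ p
opp≢ (_ , left)  ()
opp≢ (_ , right) ()

opp-involutive : ∀ p → opp (opp p) ≡ p
opp-involutive (_ , left)  = refl
opp-involutive (_ , right) = refl

same-layer : ∀ ℓ s s′ → (ℓ , s′) ≡ (ℓ , s) ⊎ (ℓ , s′) ≡ opp (ℓ , s)
same-layer ℓ left  left  = inj₁ refl
same-layer ℓ left  right = inj₂ refl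
same-layer ℓ right left  = inj₂ refl
same-layer ℓ right right = inj₁ refl

Vertex : ℕ → Set
Vertex m = Part × Fin m

layer : ∀ {m} → Vertex m → Layer
layer ((ℓ , _) , _) = ℓ

module Encoding (m : ℕ) where

  size : ℕ
  size = m + (m + (m + m))

  enc : Vertex m → Fin size
  enc (A₁ , i) = i ↑ˡ (m + (m + m))
  enc (B₁ , i) = m ↑ʳ (i ↑ˡ (m + m))
  enc (A₂ , i) = m ↑ʳ (m ↑ʳ (i ↑ˡ m))
  enc (B₂ , i) = m ↑ʳ (m ↑ʳ (m ↑ʳ i))

  private
    dec-lower : Fin m ⊎ Fin m → Vertex m
    dec-lower = [ (A₂ ,_) , (B₂ ,_) ]′

    dec-B₁⋯ : Fin m ⊎ Fin (m + m) → Vertex m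
    dec-B₁⋯ = [ (B₁ ,_) , dec-lower ∘ splitAt m ]′

    dec-A₁⋯ : Fin m ⊎ Fin (m + (m + m)) → Vertex m
    dec-A₁⋯ = [ (A₁ ,_) , dec-B₁⋯ ∘ splitAt m ]′

    enc-dec-lower : ∀ s → enc (dec-lower s) ≡ m ↑ʳ (m ↑ʳ join m m s)
    enc-dec-lower (inj₁ _) = refl
    enc-dec-lower (inj₂ _) = refl

    enc-dec-B₁⋯ : ∀ s → enc (dec-B₁⋯ s) ≡ m ↑ʳ join m (m + m) s
    enc-dec-B₁⋯ (inj₁ _) = refl
    enc-dec-B₁⋯ (inj₂ v) =
      trans (enc-dec-lower (splitAt m v)) (cong (λ z → m ↑ʳ (m ↑ʳ z)) (join-splitAt m m v))

    enc-dec-A₁⋯ : ∀ s → enc (dec-A₁⋯ s) ≡ join m (m + (m + m)) s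
    enc-dec-A₁⋯ (inj₁ _) = refl
    enc-dec-A₁⋯ (inj₂ v) = trans (enc-dec-B₁⋯ (splitAt m v)) (cong (m ↑ʳ_) (join-splitAt m (m + m) v))

  dec : Fin size → Vertex m
  dec = dec-A₁⋯ ∘ splitAt m

  dec-enc : ∀ x → dec (enc x) ≡ x
  dec-enc (A₁ , i) = cong dec-A₁⋯ (splitAt-↑ˡ m i (m + (m + m)))
  dec-enc (B₁ , i) = trans (cong dec-A₁⋯ (splitAt-↑ʳ m (m + (m + m)) _))
                     (cong dec-B₁⋯ (splitAt-↑ˡ m i (m + m)))
  dec-enc (A₂ , i) = trans (cong dec-A₁⋯ (splitAt-↑ʳ m (m + (m + m)) _))
                     (trans (cong dec-B₁⋯ (splitAt-↑ʳ m (m + m) _)) (cong dec-lower (splitAt-↑ˡ m i m)))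
  dec-enc (B₂ , i) = trans (cong dec-A₁⋯ (splitAt-↑ʳ m (m + (m + m)) _))
                     (trans (cong dec-B₁⋯ (splitAt-↑ʳ m (m + m) _)) (cong dec-lower (splitAt-↑ʳ m m i)))

  enc-dec : ∀ v → enc (dec v) ≡ v
  enc-dec v = trans (enc-dec-A₁⋯ (splitAt m v)) (join-splitAt m (m + (m + m)) v)

  dec-injective : ∀ {u v} → dec u ≡ dec v → u ≡ v
  dec-injective {u} {v} eq = trans (sym (enc-dec u)) (trans (cong enc eq) (enc-dec v))

  enc-injective : ∀ {x y} → enc x ≡ enc y → x ≡ y
  enc-injective {x} {y} eq = trans (sym (dec-enc x)) (trans (cong dec eq) (dec-enc y))

  block : Part → List (Fin size)
  block p = tabulate (λ i → enc (p , i))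

  allFin-blocks : allFin size ≡ block A₁ ++ (block B₁ ++ (block A₂ ++ block B₂))
  allFin-blocks = trans (tabulate-↑ m (λ v → v))
    (cong (block A₁ ++_) (trans (tabulate-↑ m (m ↑ʳ_))
      (cong (block B₁ ++_) (tabulate-↑ m (λ v → m ↑ʳ (m ↑ʳ v))))))

n+3[n+2]≡2+4[n+1] : ∀ n →
  n + (suc (suc n) + (suc (suc n) + suc (suc n))) ≡ suc (suc (suc n + (suc n + (suc n + suc n))))
n+3[n+2]≡2+4[n+1] = solve-∀

module Construction (n : ℕ) where

  t : ℕ
  t = suc (suc n)

  open Encoding t

  both-zero : Fin t → Fin t → Bool
  both-zero zero zero = true
  both-zero _    _    = false

  both-zero-sym : ∀ i j → both-zero i j ≡ both-zero j i
  both-zero-sym zero    zero    = refl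
  both-zero-sym zero    (suc _) = refl
  both-zero-sym (suc _) zero    = refl
  both-zero-sym (suc _) (suc _) = refl

  hadj : Vertex t → Vertex t → Bool
  hadj (A₁ , _) (B₁ , _) = true
  hadj (B₁ , _) (A₁ , _) = true
  hadj (A₂ , _) (B₂ , _) = true
  hadj (B₂ , _) (A₂ , _) = true
  hadj (A₁ , i) (B₂ , j) = both-zero i j
  hadj (B₂ , i) (A₁ , j) = both-zero i j
  hadj _        _        = false

  hadj-sym : ∀ x y → hadj x y ≡ hadj y x
  hadj-sym (A₁ , i) (B₂ , j) = both-zero-sym i j
  hadj-sym (B₂ , i) (A₁ , j) = both-zero-sym i j
  hadj-sym (A₁ , _) (A₁ , _) = refl
  hadj-sym (A₁ , _) (B₁ , _) = refl
  hadj-sym (A₁ , _) (A₂ , _) = refl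
  hadj-sym (B₁ , _) (A₁ , _) = refl
  hadj-sym (B₁ , _) (B₁ , _) = refl
  hadj-sym (B₁ , _) (A₂ , _) = refl
  hadj-sym (B₁ , _) (B₂ , _) = refl
  hadj-sym (A₂ , _) (A₁ , _) = refl
  hadj-sym (A₂ , _) (B₁ , _) = refl
  hadj-sym (A₂ , _) (A₂ , _) = refl
  hadj-sym (A₂ , _) (B₂ , _) = refl
  hadj-sym (B₂ , _) (B₁ , _) = refl
  hadj-sym (B₂ , _) (A₂ , _) = refl
  hadj-sym (B₂ , _) (B₂ , _) = refl

  hadj-opp : ∀ p i j → hadj (p , i) (opp p , j) ≡ true
  hadj-opp A₁ i j = refl
  hadj-opp B₁ i j = refl
  hadj-opp A₂ i j = refl
  hadj-opp B₂ i j = refl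

  hadj-same : ∀ p i j → hadj (p , i) (p , j) ≢ true
  hadj-same A₁ i j ()
  hadj-same B₁ i j ()
  hadj-same A₂ i j ()
  hadj-same B₂ i j ()

  graph : Graph
  graph = record
    { order  = size
    ; adj    = λ u v → not (hadj (dec u) (dec v)) ∧ not (does (u Fin.≟ v))
    ; sym    = λ u v → cong₂ (λ h e → not h ∧ not e) (hadj-sym (dec u) (dec v)) (≟-sym u v)
    ; irrefl = λ v → trans (cong (λ e → not (hadj (dec v) (dec v)) ∧ not e) (dec-true (v Fin.≟ v) refl))
                           (∧-zeroʳ _)
    }
    where
    ≟-sym : ∀ u v → does (u Fin.≟ v) ≡ does (v Fin.≟ u)
    ≟-sym u v with u Fin.≟ v
    ... | yes u≡v = sym (dec-true (v Fin.≟ u) (sym u≡v))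
    ... | no u≢v  = sym (dec-false (v Fin.≟ u) (u≢v ∘ sym))

  adj-intro : ∀ {u v} → hadj (dec u) (dec v) ≢ true → u ≢ v → Adj graph u v
  adj-intro {u} {v} ¬H u≢v rewrite ¬-not ¬H | dec-false (u Fin.≟ v) u≢v = refl

  adj⇒¬H : ∀ {u v} → Adj graph u v → hadj (dec u) (dec v) ≢ true
  adj⇒¬H {u} {v} uv H rewrite H with uv
  ... | ()

  ¬adj⇒H : ∀ {u v} → ¬ Adj graph u v → u ≢ v → hadj (dec u) (dec v) ≡ true
  ¬adj⇒H {u} {v} u≁v u≢v = decidable-stable (hadj (dec u) (dec v) ≟ᴮ true) λ ¬H → u≁v (adj-intro ¬H u≢v)

  adj-enc : ∀ x y → hadj x y ≢ true → x ≢ y → Adj graph (enc x) (enc y)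
  adj-enc x y ¬H x≢y =
    adj-intro (λ H → ¬H (trans (sym (cong₂ hadj (dec-enc x) (dec-enc y))) H)) (x≢y ∘ enc-injective)

  ¬adj-if-H : ∀ {x y} u v → dec u ≡ x → dec v ≡ y → hadj x y ≡ true → ¬ Adj graph u v
  ¬adj-if-H u v refl refl H uv = adj⇒¬H {u} {v} uv H

  Regular : Vertex t → Set
  Regular (p , i) = ∀ y → hadj (p , i) y ≡ true → proj₁ y ≡ opp p

  regular-suc : ∀ p i → Regular (p , suc i)
  regular-suc A₁ _ (B₁ , _) _ = refl
  regular-suc A₁ _ (A₁ , _) ()
  regular-suc A₁ _ (A₂ , _) ()
  regular-suc A₁ _ (B₂ , _) ()
  regular-suc B₁ _ (A₁ , _) _ = refl
  regular-suc B₁ _ (B₁ , _) ()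
  regular-suc B₁ _ (A₂ , _) ()
  regular-suc B₁ _ (B₂ , _) ()
  regular-suc A₂ _ (B₂ , _) _ = refl
  regular-suc A₂ _ (A₁ , _) ()
  regular-suc A₂ _ (B₁ , _) ()
  regular-suc A₂ _ (A₂ , _) ()
  regular-suc B₂ _ (A₂ , _) _ = refl
  regular-suc B₂ _ (A₁ , _) ()
  regular-suc B₂ _ (B₁ , _) ()
  regular-suc B₂ _ (B₂ , _) ()

  regular-B₁⁰ : Regular (B₁ , zero)
  regular-B₁⁰ (A₁ , _) _ = refl
  regular-B₁⁰ (B₁ , _) ()
  regular-B₁⁰ (A₂ , _) ()
  regular-B₁⁰ (B₂ , _) ()

  regular-A₂⁰ : Regular (A₂ , zero)
  regular-A₂⁰ (B₂ , _) _ = refl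
  regular-A₂⁰ (A₁ , _) ()
  regular-A₂⁰ (B₁ , _) ()
  regular-A₂⁰ (A₂ , _) ()

  adj-across : ∀ x y → Regular x → layer y ≢ layer x → Adj graph (enc x) (enc y)
  adj-across x y regular ℓ≢ =
    adj-enc x y (λ H → ℓ≢ (cong proj₁ (regular y H))) (λ x≡y → ℓ≢ (cong layer (sym x≡y)))

  module Singles = Encoding (suc n)

  K : ℕ
  K = suc (suc Singles.size)

  layerColour : Layer → Fin K
  layerColour upper = zero
  layerColour lower = suc zero

  col : Vertex t → Fin K
  col (p , zero)  = layerColour (proj₁ p)
  col (p , suc i) = suc (suc (Singles.enc (p , i)))

  c₀ : V graph → Fin K
  c₀ = col ∘ dec

  c₀-enc : ∀ x → c₀ (enc x) ≡ col x
  c₀-enc x = cong col (dec-enc x)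

  layerColour≢suc-suc : ∀ ℓ z → layerColour ℓ ≢ suc (suc z)
  layerColour≢suc-suc upper _ ()
  layerColour≢suc-suc lower _ ()

  layerColour-injective : ∀ {ℓ ℓ′} → layerColour ℓ ≡ layerColour ℓ′ → ℓ ≡ ℓ′
  layerColour-injective {upper} {upper} _ = refl
  layerColour-injective {lower} {lower} _ = refl
  layerColour-injective {upper} {lower} ()
  layerColour-injective {lower} {upper} ()

  col-fibre : ∀ x y → col x ≡ col y → x ≡ y ⊎ ∃[ p ] (x ≡ (p , zero) × y ≡ (opp p , zero))
  col-fibre ((ℓ , s) , zero) ((ℓ′ , s′) , zero) e with layerColour-injective e
  ... | refl with same-layer ℓ s s′
  ...   | inj₁ same     = inj₁ (cong (_, zero) (sym same))
  ...   | inj₂ opposite = inj₂ (_ , refl , cong (_, zero) opposite)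
  col-fibre (p , zero)  (q , suc j) e = ⊥-elim (layerColour≢suc-suc _ _ e)
  col-fibre (p , suc i) (q , zero)  e = ⊥-elim (layerColour≢suc-suc _ _ (sym e))
  col-fibre (p , suc i) (q , suc j) e =
    inj₁ (cong (λ { (r , k) → r , suc k }) (Singles.enc-injective (suc-injective (suc-injective e))))

  distinct-same-colour : ∀ {a b} → a ≢ b → c₀ a ≡ c₀ b →
    ∃[ p ] (dec a ≡ (p , zero) × dec b ≡ (opp p , zero))
  distinct-same-colour {a} {b} a≢b e with col-fibre (dec a) (dec b) e
  ... | inj₁ same = ⊥-elim (a≢b (dec-injective same))
  ... | inj₂ pair = pair

  c₀-proper : Proper graph c₀
  c₀-proper a b ab e with distinct-same-colour (adj⇒≢ graph {a} {b} ab) e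
  ... | p , da , db = ¬adj-if-H a b da db (hadj-opp p zero zero) ab

  c₀-size≤2 : ClassSize≤2 graph c₀
  c₀-size≤2 a b d a≢b b≢d a≢d ab bd with distinct-same-colour a≢b ab | distinct-same-colour b≢d bd
  ... | p , da , db | q , db′ , dd = a≢d (dec-injective (begin
    dec a                  ≡⟨ da ⟩
    (p , zero)             ≡⟨ cong (_, zero) (sym (opp-involutive p)) ⟩
    (opp (opp p) , zero)   ≡⟨ cong (λ r → opp r , zero) (cong proj₁ (trans (sym db) db′)) ⟩
    (opp q , zero)         ≡⟨ sym dd ⟩
    dec d                  ∎))
    where open ≡-Reasoning

  layers-joined : ∀ P Q → proj₁ P ≢ proj₁ Q →
    hadj (P , zero) (Q , zero) ≡ true ⊎ hadj (Q , zero) (opp P , zero) ≡ true ⊎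
    hadj (opp P , zero) (opp Q , zero) ≡ true ⊎ hadj (opp Q , zero) (P , zero) ≡ true
  layers-joined (upper , _) (upper , _) ℓ≢ = ⊥-elim (ℓ≢ refl)
  layers-joined (lower , _) (lower , _) ℓ≢ = ⊥-elim (ℓ≢ refl)
  layers-joined A₁ B₂ _ = inj₁ refl
  layers-joined A₁ A₂ _ = inj₂ (inj₂ (inj₂ refl))
  layers-joined B₁ B₂ _ = inj₂ (inj₁ refl)
  layers-joined B₁ A₂ _ = inj₂ (inj₂ (inj₁ refl))
  layers-joined A₂ A₁ _ = inj₂ (inj₁ refl)
  layers-joined A₂ B₁ _ = inj₂ (inj₂ (inj₁ refl))
  layers-joined B₂ A₁ _ = inj₁ refl
  layers-joined B₂ B₁ _ = inj₂ (inj₂ (inj₂ refl))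

  c₀-noC₄ : NoBichromaticC₄ graph c₀
  c₀-noC₄ a b p q a≢b ab p≢q pq ca≢cp ap pb bq qa
    with distinct-same-colour a≢b ab | distinct-same-colour p≢q pq
  ... | P , da , db | Q , dp , dq
    with layers-joined P Q
           (λ ℓ≡ → ca≢cp (trans (cong col da) (trans (cong layerColour ℓ≡) (sym (cong col dp)))))
  ... | inj₁ H               = ¬adj-if-H a p da dp H ap
  ... | inj₂ (inj₁ H)        = ¬adj-if-H p b dp db H pb
  ... | inj₂ (inj₂ (inj₁ H)) = ¬adj-if-H b q db dq H bq
  ... | inj₂ (inj₂ (inj₂ H)) = ¬adj-if-H q a dq da H qa

  c₀-acyclic : Acyclic graph c₀
  c₀-acyclic = acyclic-if-noBichromaticC₄ graph c₀ c₀-proper c₀-size≤2 c₀-noC₄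

  representative : Fin K → Vertex t
  representative zero          = B₁ , zero
  representative (suc zero)    = A₂ , zero
  representative (suc (suc z)) = proj₁ (Singles.dec z) , suc (proj₂ (Singles.dec z))

  col-representative : ∀ i → col (representative i) ≡ i
  col-representative zero          = refl
  col-representative (suc zero)    = refl
  col-representative (suc (suc z)) = cong (λ w → suc (suc w)) (Singles.enc-dec z)

  regular-representative : ∀ i → Regular (representative i)
  regular-representative zero          = regular-B₁⁰
  regular-representative (suc zero)    = regular-A₂⁰
  regular-representative (suc (suc z)) = regular-suc _ _

  c₀-surjective : ∀ i → ∃[ v ] c₀ v ≡ i
  c₀-surjective i = enc (representative i) , trans (c₀-enc (representative i)) (col-representative i)

  base-colour-nearby : ∀ p i →
    c₀ (enc (p , i)) ≡ col (p , zero) ⊎ ∃[ z ] (Adj graph (enc (p , i)) z × c₀ z ≡ col (p , zero))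
  base-colour-nearby p zero    = inj₁ (c₀-enc (p , zero))
  base-colour-nearby p (suc i) =
    inj₂ (enc (p , zero) ,
          adj-enc (p , suc i) (p , zero) (hadj-same p (suc i) zero) (λ e → 0≢1+n (sym (cong proj₂ e))) ,
          c₀-enc (p , zero))

  across-colour≢ : ∀ p i → col (across p , zero) ≢ col (p , i)
  across-colour≢ p zero    e = flipᴸ≢ _ (layerColour-injective e)
  across-colour≢ p (suc i) e = layerColour≢suc-suc _ _ e

  -- v = (p , i) must take the colour of an H-neighbour x = (opp p , suc j); then v and x together
  -- with the class {(across p , 0), (opp (across p) , 0)} of the other layer form a bichromatic C₄.
  no-acyclic-step-at : ∀ {p i} → Regular (p , i) → ∀ c′ →
    RecoloringStep graph c₀ (col (p , i)) c′ → ¬ Acyclic graph c′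
  no-acyclic-step-at {p} {i} regular c′ (_ , unchanged , recoloured) acyclic′ =
    acyclic⇒noBichromaticC₄ graph c′ acyclic′ v x m₁ m₂ v≢x c′v≡c′x m₁≢m₂ c′m₁≡c′m₂ c′v≢c′m₁
      (adj-across _ (across p , zero) regular (flipᴸ≢ _))
      (adj-comm graph {x} {m₁} (adj-across _ (across p , zero) regular-x (flipᴸ≢ _)))
      (adj-across _ (opp (across p) , zero) regular-x (flipᴸ≢ _))
      (adj-comm graph {v} {m₂} (adj-across _ (opp (across p) , zero) regular (flipᴸ≢ _)))
    where
    v m₁ m₂ : V graph
    v  = enc (p , i)
    m₁ = enc (across p , zero)
    m₂ = enc (opp (across p) , zero)

    fresh : c′ v ≢ c₀ v
    fresh = proj₁ (recoloured v (c₀-enc (p , i)))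
    away : ∀ z → Adj graph v z → c′ v ≢ c₀ z
    away = proj₂ (recoloured v (c₀-enc (p , i)))

    target : Vertex t
    target = representative (c′ v)
    col-target : col target ≡ c′ v
    col-target = col-representative (c′ v)

    H-target : hadj (p , i) target ≡ true
    H-target = trans (cong₂ hadj (sym (dec-enc (p , i))) (sym (dec-enc target)))
      (¬adj⇒H {v} {enc target} (λ vx → away _ vx (sym (trans (c₀-enc target) col-target)))
              (λ v≡x → fresh (trans (sym col-target) (trans (sym (c₀-enc target)) (cong c₀ (sym v≡x))))))

    target-index : ∃[ j ] target ≡ (opp p , suc j)
    target-index with target | regular target H-target | col-target
    ... | (_ , suc j) | refl | _ = j , refl
    ... | (_ , zero)  | refl | col≡ with base-colour-nearby p i
    ...   | inj₁ here              = ⊥-elim (fresh (trans (sym col≡) (sym here)))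
    ...   | inj₂ (z , vz , there) = ⊥-elim (away z vz (trans (sym col≡) (sym there)))

    j = proj₁ target-index
    x = enc (opp p , suc j)
    regular-x = regular-suc (opp p) j

    c₀x : c₀ x ≡ c′ v
    c₀x = trans (c₀-enc (opp p , suc j)) (trans (cong col (sym (proj₂ target-index))) col-target)

    v≢x : v ≢ x
    v≢x v≡x = fresh (trans (sym c₀x) (cong c₀ (sym v≡x)))
    c′v≡c′x : c′ v ≡ c′ x
    c′v≡c′x = trans (sym c₀x)
      (sym (unchanged x (λ e → fresh (trans (sym c₀x) (trans e (sym (c₀-enc (p , i))))))))

    other-class : ∀ s → c′ (enc ((flipᴸ (proj₁ p) , s) , zero)) ≡ layerColour (flipᴸ (proj₁ p))
    other-class s =
      trans (unchanged m (across-colour≢ p i ∘ trans (sym (c₀-enc (q , zero))))) (c₀-enc (q , zero))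
      where
      q = flipᴸ (proj₁ p) , s
      m = enc (q , zero)
    m₁≢m₂ : m₁ ≢ m₂
    m₁≢m₂ e = opp≢ (across p) (sym (cong proj₁ (enc-injective e)))
    c′m₁≡c′m₂ : c′ m₁ ≡ c′ m₂
    c′m₁≡c′m₂ = trans (other-class _) (sym (other-class _))
    c′v≢c′m₁ : c′ v ≢ c′ m₁
    c′v≢c′m₁ e = layerColour≢suc-suc _ _
      (trans (sym (other-class _)) (trans (sym e) (trans (sym c₀x) (c₀-enc (opp p , suc j)))))

  no-acyclic-step : ¬ AcyclicStepApplicable graph c₀
  no-acyclic-step (i , c′ , step , _ , acyclic′) =
    no-acyclic-step-at (regular-representative i) c′
      (subst (λ j → RecoloringStep graph c₀ j c′) (sym (col-representative i)) step) acyclic′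

  c₀-good : Good graph K c₀
  c₀-good = (c₀-proper , c₀-surjective) , c₀-acyclic , no-acyclic-step

  degree-bound : ∀ v → degree graph v ≤ t + (t + t)
  degree-bound v = subst (λ vs → count vs ≤ t + (t + t)) (sym allFin-blocks)
    (subst (_≤ t + (t + t)) (sym split)
      (sum-of-four≤ (bound A₁) (bound B₁) (bound A₂) (bound B₂) (zero-block p opp-block-empty)))
    where
    P? = λ w → T? (adj graph v w)
    count : List (V graph) → ℕ
    count vs = length (filter P? vs)
    bound : ∀ q → count (block q) ≤ t
    bound q = count-tabulate≤ P? (λ i → enc (q , i))
    split : count (block A₁ ++ (block B₁ ++ (block A₂ ++ block B₂))) ≡
            count (block A₁) + (count (block B₁) + (count (block A₂) + count (block B₂)))
    split = trans (count-++ P? (block A₁) _) (cong (count (block A₁) +_)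
              (trans (count-++ P? (block B₁) _) (cong (count (block B₁) +_) (count-++ P? (block A₂) _))))
    p = proj₁ (dec v)
    opp-block-empty : count (block (opp p)) ≡ 0
    opp-block-empty = count-tabulate-none P? (λ j → enc (opp p , j)) λ j vw →
      adj⇒¬H {v} {enc (opp p , j)} (Equivalence.to T-≡ vw)
        (trans (cong (hadj (dec v)) (dec-enc (opp p , j))) (hadj-opp p (proj₂ (dec v)) j))
    zero-block : ∀ q → count (block (opp q)) ≡ 0 →
      count (block A₁) ≡ 0 ⊎ count (block B₁) ≡ 0 ⊎ count (block A₂) ≡ 0 ⊎ count (block B₂) ≡ 0
    zero-block A₁ empty = inj₂ (inj₁ empty)
    zero-block B₁ empty = inj₁ empty
    zero-block A₂ empty = inj₂ (inj₂ (inj₂ empty))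
    zero-block B₂ empty = inj₂ (inj₂ (inj₁ empty))

  other : Fin t → Fin t
  other zero    = suc zero
  other (suc _) = zero

  other≢ : ∀ i → other i ≢ i
  other≢ zero    ()
  other≢ (suc _) ()

  spare : ∀ u v → u ≢ v → ¬ Adj graph u v → SpareNonEdge graph u v
  spare u v u≢v u≁v = record
    { w   = enc (opp p , other j)
    ; y   = enc (p , other i)
    ; w≢y = λ e → opp≢ p (cong proj₁ (enc-injective e))
    ; w≁y = ¬adj-if-H (enc (opp p , other j)) (enc (p , other i))
              (dec-enc (opp p , other j)) (dec-enc (p , other i))
              (trans (hadj-sym (opp p , other j) (p , other i)) (hadj-opp p (other i) (other j)))
    ; w≢u = λ e → opp≢ p (cong proj₁ (decoded (opp p , other j) e))
    ; w≢v = λ e → other≢ j (cong proj₂ (decoded (opp p , other j) e))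
    ; y≢u = λ e → other≢ i (cong proj₂ (decoded (p , other i) e))
    ; y≢v = λ e → hadj-same p i (other i)
                    (trans (cong (hadj (dec u)) (decoded (p , other i) e)) (¬adj⇒H {u} {v} u≁v u≢v))
    ; u≁w = ¬adj-if-H u (enc (opp p , other j)) refl (dec-enc (opp p , other j)) (hadj-opp p i (other j))
    }
    where
    p = proj₁ (dec u)
    i = proj₂ (dec u)
    j = proj₂ (dec v)
    decoded : ∀ x {z} → enc x ≡ z → x ≡ dec z
    decoded x e = trans (sym (dec-enc x)) (cong dec e)

  non-edge : ∃₂ λ u v → u ≢ v × ¬ Adj graph u v
  non-edge = enc (A₁ , zero) , enc (B₁ , zero) , (λ e → opp≢ A₁ (sym (cong proj₁ (enc-injective e)))) ,
             ¬adj-if-H (enc (A₁ , zero)) (enc (B₁ , zero)) (dec-enc (A₁ , zero)) (dec-enc (B₁ , zero)) refl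

  n+3t≡K : n + (t + (t + t)) ≡ K
  n+3t≡K = n+3[n+2]≡2+4[n+1] n

  colours≤K : ∀ k (c : V graph → Fin k) → Good graph k c → k ≤ K
  colours≤K k c good = decidable-stable (k ≤? K) λ k≰K →
    good⇒¬¬twoRepeated graph c good non-edge spare λ two →
      k≰K (subst (k ≤_) n+3t≡K (twoRepeated⇒≤ c (proj₂ (proj₁ good)) two))

  isAb : IsAb graph K
  isAb = (c₀ , c₀-good) , colours≤K

  gap : ∀ M → M ≤ n → M + Δ graph ≤ K
  gap M M≤n = ℕ.≤-trans (ℕ.+-mono-≤ M≤n (Δ≤ graph degree-bound)) (ℕ.≤-reflexive n+3t≡K)

theorem3 : Σ[ G ∈ (ℕ → Graph) ] Σ[ a ∈ (ℕ → ℕ) ]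
    ((∀ (n : ℕ) → IsAb (G n) (a n))
    × (∀ (M : ℕ) → Σ[ N ∈ ℕ ] (∀ (n : ℕ) → N ≤ n → M + Δ (G n) ≤ a n)))
theorem3 = Construction.graph , Construction.K , Construction.isAb , λ M → M , λ n → Construction.gap n M
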